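{- Let $G$ be a finite simple graph, let $C$ be a longest cycle in $G$ (with a fixed orientation), and let $P = x\overrightarrow{P}y$ be a longest path in $G \setminus C$, of length $\bar p \geq 0$ (if $\bar p=0$ then $x=y$). Suppose $N_C(x) = N_C(y)$ and $|N_C(x)| \geq 2$. Let $\xi_1,\dots,\xi_s$ be the elements of $N_C(x)\cup N_C(y)$ in consecutive order along $C$, and let $I_i = \xi_i\overrightarrow{C}\xi_{i+1}$ and $I_i^* = \xi_i^+\overrightarrow{C}\xi_{i+1}^-$ for $i=1,\dots,s$ (with $\xi_{s+1}=\xi_1$). Then for any two distinct elementary segments $I_a, I_b$: (a1) if $L$ is an intermediate path between $I_a$ and $I_b$, then $|I_a| + |I_b| \geq 2\bar p + 2|L| + 4$; (a2) if every member of $\Upsilon(I_a,I_b)$ is an edge (i.e. $\Upsilon(I_a,I_b)\subseteq E(G)$) and $|\Upsilon(I_a,I_b)| = i$ for some $i \in \{1,2,3\}$, then $|I_a| + |I_b| \geq 2\bar p + i + 5$; (a3) if $\Upsilon(I_a,I_b) \subseteq E(G)$ and $\Upsilon(I_a,I_b)$ contains two independent (vertex-disjoint) intermediate edges, then $|I_a| + |I_b| \geq 2\bar p + 8$.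
   Context: Graphs are finite, undirected, without loops or multiple edges; the length $|Q|$ of a path or cycle is its number of edges. $G\setminus C$ is the subgraph induced by $V(G)\setminus V(C)$; $N_C(v)=N(v)\cap V(C)$. For an oriented cycle $\overrightarrow{C}$ and $u,v\in V(C)$, $u\overrightarrow{C}v$ is the subpath of $C$ from $u$ to $v$ in the chosen direction; $u^+$ and $u^-$ are the successor and predecessor of $u$ on $\overrightarrow{C}$. The segments $I_1,\dots,I_s$ are called elementary segments. A path $L = z\overrightarrow{L}w$ is an intermediate path between two distinct elementary segments $I_a$ and $I_b$ if $z \in V(I_a^*)$, $w \in V(I_b^*)$ and $V(L)\cap V(C\cup P) = \{z,w\}$. $\Upsilon(I_a,I_b)$ denotes the set of all intermediate paths between $I_a$ and $I_b$; an intermediate path of length 1 is called an intermediate edge. -}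

module Defs where

open import Data.Nat using (ℕ; zero; suc; _+_; _∸_; _≤_; _<_; _≤?_)
open import Data.Fin using (Fin; toℕ)
open import Data.List using (List; []; _∷_; _++_; [_]; length; head; last; lookup)
open import Data.List.Relation.Unary.Linked using (Linked)
open import Data.List.Relation.Unary.Unique.Propositional using (Unique)
open import Data.List.Membership.Propositional using (_∈_; _∉_)
open import Data.Maybe using (just)
open import Data.Product using (Σ; ∃; ∃-syntax; _×_; _,_)
open import Data.Sum using (_⊎_)
open import Relation.Nullary using (¬_; yes; no)
open import Relation.Binary.PropositionalEquality using (_≡_; _≢_)

-- A finite simple graph on vertex set Fin n: symmetric, irreflexive adjacency
-- (no loops; a relation cannot have multiple edges).
record SimpleGraph (n : ℕ) : Set₁ where
  field
    Adj    : Fin n → Fin n → Set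
    sym    : ∀ {u v} → Adj u v → Adj v u
    irrefl : ∀ {u} → ¬ Adj u u
open SimpleGraph public

module _ {n : ℕ} (G : SimpleGraph n) where

  -- A path, given by its (nonempty) list of distinct vertices, consecutive ones adjacent.
  -- Its length |Q| is (length of list) ∸ 1.
  IsPath : List (Fin n) → Set
  IsPath vs = (vs ≢ []) × Unique vs × Linked (Adj G) vs

  -- A cycle, given by its list of distinct vertices c₀ … c_{m-1} in the chosen
  -- orientation (m ≥ 3); c_i adjacent to c_{i+1} and c_{m-1} adjacent to c₀.
  -- Its length |C| equals m = length of the list.
  IsCycle : List (Fin n) → Set
  IsCycle cs = (3 ≤ length cs) × Unique cs
             × (∃[ c₀ ] ∃[ rest ] (cs ≡ c₀ ∷ rest) × Linked (Adj G) (cs ++ [ c₀ ]))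

  IsLongestCycle : List (Fin n) → Set
  IsLongestCycle cs = IsCycle cs × (∀ ds → IsCycle ds → length ds ≤ length cs)

  IsPathOutside : List (Fin n) → List (Fin n) → Set
  IsPathOutside cs ps = IsPath ps × (∀ v → v ∈ ps → v ∉ cs)

  IsLongestPathOutside : List (Fin n) → List (Fin n) → Set
  IsLongestPathOutside cs ps =
    IsPathOutside cs ps × (∀ qs → IsPathOutside cs qs → length qs ≤ length ps)

-- Forward distance from position p to position k along an oriented cycle of
-- length m (positions are indices 0..m-1); the length of the subpath p→C→k.
fwd : (m : ℕ) → ℕ → ℕ → ℕ
fwd m p k with p ≤? k
... | yes _ = k ∸ p
... | no  _ = (m ∸ p) + k

module _ {n : ℕ} (G : SimpleGraph n) (cs : List (Fin n)) (x y : Fin n) where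

  Pos : Set
  Pos = Fin (length cs)

  -- v ∈ N_C(x) ∪ N_C(y)   (v ∈ C is guaranteed by taking v = lookup cs k)
  InN : Fin n → Set
  InN v = Adj G x v ⊎ Adj G y v

  segLen : Pos → Pos → ℕ
  segLen p q = fwd (length cs) (toℕ p) (toℕ q)

  StrictlyBetween : Pos → Pos → Pos → Set
  StrictlyBetween p q k = (0 < fwd (length cs) (toℕ p) (toℕ k))
                        × (fwd (length cs) (toℕ p) (toℕ k) < segLen p q)

  IsElemSeg : Pos → Pos → Set
  IsElemSeg p q = (p ≢ q) × InN (lookup cs p) × InN (lookup cs q)
                × (∀ k → StrictlyBetween p q k → ¬ InN (lookup cs k))

  InInterior : Pos → Pos → Fin n → Set
  InInterior p q v = ∃[ k ] StrictlyBetween p q k × (lookup cs k ≡ v)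

  IsIntermediate : List (Fin n) → Pos → Pos → Pos → Pos → List (Fin n) → Set
  IsIntermediate ps pa qa pb qb L =
    IsPath G L × ∃[ z ] ∃[ w ] (head L ≡ just z) × (last L ≡ just w)
      × InInterior pa qa z × InInterior pb qb w
      × (∀ v → v ∈ L → (v ∈ cs ⊎ v ∈ ps) → (v ≡ z ⊎ v ≡ w))

-- Index the longest cycle C by ℕ, C[ t ] being its vertex at position t mod |C|, so that ξ_a, ξ_{a+1},
-- ξ_b, ξ_{b+1} sit at positions p₀ ≤ p₁ ≤ p₂ < p₃ ≤ p₀ + |C|; each of them is adjacent to both x and y.
-- Every bound compares |C| with the length of a cycle through P. An intermediate path L from z ∈ I_a*
-- to w ∈ I_b* closes the cycles  ξ_b C⁻ z L w C⁺ ξ_a x P y ξ_b  and  ξ_{a+1} C⁺ w L⁻ z C⁻ ξ_{b+1} x P y ξ_{a+1},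
-- whence |P| + |L| + 2 ≤ (z − p₀) + (w − p₂) and |P| + |L| + 2 ≤ (p₁ − z) + (p₃ − w); their sum is (a1).
-- Two crossing intermediate edges z₁w₁, z₂w₂ (z₁ < z₂, w₂ < w₁) close two further cycles, each using
-- both edges, whose lengths together give 2|P| + 8 ≤ |I_a| + |I_b|. For (a2) and (a3) an intermediate
-- edge zw is recorded by σ = z + w: by the bounds above all σ lie in an interval of length
-- |I_a| + |I_b| − 2|P| − 6, distinct edges with equal σ are independent, and independent edges
-- either cross or have σ at least 2 apart.
module Submission where

open import Defs renaming (sym to Adj-sym)
open import Data.Nat
  using (ℕ; zero; suc; _+_; _*_; _∸_; _≤_; _<_; z≤n; s≤s; _≤?_; _≟_; _%_; _/_; NonZero)
open import Data.Nat.Properties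
open import Data.Nat.DivMod
  using (m≡m%n+[m/n]*n; [m+kn]%n≡m%n; [m+n]%n≡m%n; m*n%n≡0; m<n⇒m%n≡m; m%n<n; n%n≡0)
open import Data.Nat.Tactic.RingSolver using (solve-∀)
open import Data.Fin using (Fin; toℕ) renaming (zero to fzero; suc to fsuc)
open import Data.Fin.Properties using (toℕ<n; toℕ-injective)
open import Data.List
  using (List; []; _∷_; _++_; [_]; _∷ʳ_; length; head; last; lookup; reverse; initLast; _∷ʳ′_)
open import Data.List.Properties using (length-++; ++-identityʳ; length-reverse; unfold-reverse)
open import Data.List.Relation.Unary.Linked using (Linked; []; [-]; _∷_)
open import Data.List.Relation.Unary.Unique.Propositional using (Unique)
import Data.List.Relation.Unary.Unique.Propositional.Properties as Unique
open import Data.List.Relation.Unary.AllPairs using (AllPairs; []; _∷_)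
open import Data.List.Relation.Unary.All using (All; []; _∷_; tabulate)
import Data.List.Relation.Unary.All as All
import Data.List.Relation.Unary.All.Properties as All
open import Data.List.Relation.Unary.Any using (here; there)
import Data.List.Relation.Unary.Any.Properties as Any
open import Data.List.Relation.Binary.Disjoint.Propositional using (Disjoint)
import Data.List.Relation.Binary.Disjoint.Propositional.Properties as Disjoint
import Data.List.Relation.Binary.Permutation.Setoid as Perm
import Data.List.Relation.Binary.Permutation.Setoid.Properties as PermProps
open import Data.List.Membership.Propositional using (_∈_; _∉_)
open import Data.List.Membership.Propositional.Properties using (∈-lookup; ∈-++⁺ˡ)
open import Data.Maybe using (just)
open import Data.Maybe.Properties using (just-injective)
open import Data.Product using (∃-syntax; _×_; _,_; proj₁; proj₂)
open import Data.Sum using (_⊎_; inj₁; inj₂)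
open import Data.Empty using (⊥; ⊥-elim)
open import Function using (_∘_)
open import Function.Bundles using (_⇔_; Equivalence)
open import Relation.Nullary using (¬_; yes; no)
open import Relation.Binary.Definitions using (tri<; tri≈; tri>)
open import Relation.Binary.PropositionalEquality
  using (_≡_; _≢_; refl; sym; trans; cong; cong₂; subst; subst₂; setoid; module ≡-Reasoning)

-- Positions on an oriented cycle of length m

≤⇒gap : ∀ {i j} → i ≤ j → ∃[ k ] j ≡ i + k
≤⇒gap i≤j = _ , sym (m+[n∸m]≡n i≤j)

[i+d]%m≡i%m⇒d≡0 : ∀ m .{{_ : NonZero m}} i d → d < m → (i + d) % m ≡ i % m → d ≡ 0
[i+d]%m≡i%m⇒d≡0 m i d d<m eq = begin
  d                      ≡⟨ sym (m<n⇒m%n≡m d<m) ⟩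
  d % m                  ≡⟨ sym ([m+kn]%n≡m%n d (i / m) m) ⟩
  (d + i / m * m) % m    ≡⟨ cong (_% m) quotients ⟩
  ((i + d) / m * m) % m  ≡⟨ m*n%n≡0 ((i + d) / m) m ⟩
  0                      ∎
  where
  open ≡-Reasoning
  quotients : d + i / m * m ≡ (i + d) / m * m
  quotients = +-cancelˡ-≡ (i % m) _ _ (begin
    i % m + (d + i / m * m)        ≡⟨ cong (i % m +_) (+-comm d _) ⟩
    i % m + (i / m * m + d)        ≡⟨ sym (+-assoc (i % m) _ d) ⟩
    i % m + i / m * m + d          ≡⟨ cong (_+ d) (sym (m≡m%n+[m/n]*n i m)) ⟩
    i + d                          ≡⟨ m≡m%n+[m/n]*n (i + d) m ⟩
    (i + d) % m + (i + d) / m * m  ≡⟨ cong (_+ (i + d) / m * m) eq ⟩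
    i % m + (i + d) / m * m        ∎)

fwd-sum : ∀ {m p} k → p < m → p + fwd m p k ≡ k ⊎ p + fwd m p k ≡ k + m
fwd-sum {m} {p} k p<m with p ≤? k
... | yes p≤k = inj₁ (m+[n∸m]≡n p≤k)
... | no  _   = inj₂ (begin
  p + ((m ∸ p) + k)  ≡⟨ sym (+-assoc p (m ∸ p) k) ⟩
  p + (m ∸ p) + k    ≡⟨ cong (_+ k) (m+[n∸m]≡n (<⇒≤ p<m)) ⟩
  m + k              ≡⟨ +-comm m k ⟩
  k + m              ∎)
  where open ≡-Reasoning

fwd-pos : ∀ {m p k} → p < m → p ≢ k → 0 < fwd m p k
fwd-pos {m} {p} {k} p<m p≢k with p ≤? k
... | yes p≤k = m<n⇒0<n∸m (≤∧≢⇒< p≤k p≢k)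
... | no  _   = ≤-trans (m<n⇒0<n∸m p<m) (m≤m+n (m ∸ p) k)

[j∸i]+[[m∸j]+i]≡m : ∀ {i j m} → i ≤ j → j ≤ m → (j ∸ i) + ((m ∸ j) + i) ≡ m
[j∸i]+[[m∸j]+i]≡m {i} {j} {m} i≤j j≤m = begin
  (j ∸ i) + ((m ∸ j) + i)  ≡⟨ cong ((j ∸ i) +_) (+-comm (m ∸ j) i) ⟩
  (j ∸ i) + (i + (m ∸ j))  ≡⟨ sym (+-assoc (j ∸ i) i (m ∸ j)) ⟩
  (j ∸ i) + i + (m ∸ j)    ≡⟨ cong (_+ (m ∸ j)) (m∸n+n≡m i≤j) ⟩
  j + (m ∸ j)              ≡⟨ m+[n∸m]≡n j≤m ⟩
  m                        ∎
  where open ≡-Reasoning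

fwd-complement : ∀ {m p k} → p < m → k < m → p ≢ k → fwd m p k + fwd m k p ≡ m
fwd-complement {m} {p} {k} p<m k<m p≢k with p ≤? k | k ≤? p
... | yes p≤k | yes k≤p = ⊥-elim (p≢k (≤-antisym p≤k k≤p))
... | yes p≤k | no  _   = [j∸i]+[[m∸j]+i]≡m p≤k (<⇒≤ k<m)
... | no  _   | yes k≤p = trans (+-comm ((m ∸ p) + k) (p ∸ k)) ([j∸i]+[[m∸j]+i]≡m k≤p (<⇒≤ p<m))
... | no  p≰k | no  k≰p = ⊥-elim (p≰k (≰⇒≥ k≰p))

-- Counting chords by the sums of their endpoints

σ : ℕ × ℕ → ℕ
σ (z , w) = z + w

2+a≤c : ∀ {a b c} → a < b → b < c → 2 + a ≤ c
2+a≤c a<b b<c = ≤-trans (s≤s a<b) b<c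

2+[a+c]≤b+d : ∀ {a b c d} → a < b → c < d → 2 + (a + c) ≤ b + d
2+[a+c]≤b+d {a} {b} {c} {d} a<b c<d = subst (_≤ b + d) (cong suc (+-suc a c)) (+-mono-≤ a<b c<d)

equal-σ⇒independent : ∀ {z₁ w₁ z₂ w₂} → (z₁ , w₁) ≢ (z₂ , w₂) → z₁ + w₁ ≡ z₂ + w₂ →
                      z₁ ≢ z₂ × w₁ ≢ w₂
equal-σ⇒independent {z₁} {w₁} {z₂} {w₂} P≢Q eq =
  (λ { refl → P≢Q (cong₂ _,_ refl (+-cancelˡ-≡ z₁ w₁ w₂ eq)) }) ,
  (λ { refl → P≢Q (cong₂ _,_ (+-cancelʳ-≡ w₁ z₁ z₂ eq) refl) })

sandwich : ∀ {h lo hi s t} k → h + lo ≤ s → k + s ≤ t → h + t ≤ hi → h + h + k + lo ≤ hi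
sandwich {h} {lo} {hi} {s} {t} k lower step upper = begin
  h + h + k + lo    ≡⟨ rearrange h k lo ⟩
  k + (h + lo) + h  ≤⟨ +-monoˡ-≤ h (+-monoʳ-≤ k lower) ⟩
  k + s + h         ≤⟨ +-monoˡ-≤ h step ⟩
  t + h             ≡⟨ +-comm t h ⟩
  h + t             ≤⟨ upper ⟩
  hi                ∎
  where
  open ≤-Reasoning
  rearrange : ∀ h k lo → h + h + k + lo ≡ k + (h + lo) + h
  rearrange = solve-∀

module ChordCounting (h lo hi : ℕ) (Chord : ℕ × ℕ → Set)
  (chord-bound : ∀ {P} → Chord P → h + lo ≤ σ P × h + σ P ≤ hi)
  (crossing : ∀ {z₁ w₁ z₂ w₂} → Chord (z₁ , w₁) → Chord (z₂ , w₂) → z₁ < z₂ → w₂ < w₁ →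
              h + h + 2 + lo ≤ hi) where

  spread : ∀ {P Q} k → Chord P → Chord Q → k + σ P ≤ σ Q → h + h + k + lo ≤ hi
  spread k cP cQ le = sandwich {h} {lo} k (proj₁ (chord-bound cP)) le (proj₂ (chord-bound cQ))

  one-chord : ∀ {P} → Chord P → h + h + 0 + lo ≤ hi
  one-chord cP = spread 0 cP cP ≤-refl

  independent-chords : ∀ {z₁ w₁ z₂ w₂} → Chord (z₁ , w₁) → Chord (z₂ , w₂) →
                       z₁ ≢ z₂ × w₁ ≢ w₂ → h + h + 2 + lo ≤ hi
  independent-chords {z₁} {w₁} {z₂} {w₂} c₁ c₂ (z₁≢z₂ , w₁≢w₂)
    with <-cmp z₁ z₂ | <-cmp w₁ w₂
  ... | tri< z< _ _ | tri< w< _ _ = spread 2 c₁ c₂ (2+[a+c]≤b+d z< w<)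
  ... | tri< z< _ _ | tri> _ _ w> = crossing c₁ c₂ z< w>
  ... | tri> _ _ z> | tri> _ _ w> = spread 2 c₂ c₁ (2+[a+c]≤b+d z> w>)
  ... | tri> _ _ z> | tri< w< _ _ = crossing c₂ c₁ z> w<
  ... | tri≈ _ z≡ _ | _           = ⊥-elim (z₁≢z₂ z≡)
  ... | _           | tri≈ _ w≡ _ = ⊥-elim (w₁≢w₂ w≡)

  two-chords : ∀ {P Q} → Chord P → Chord Q → P ≢ Q → h + h + 1 + lo ≤ hi
  two-chords {P} {Q} cP cQ P≢Q with <-cmp (σ P) (σ Q)
  ... | tri< lt _ _ = spread 1 cP cQ lt
  ... | tri> _ _ gt = spread 1 cQ cP gt
  ... | tri≈ _ eq _ = ≤-trans (+-monoˡ-≤ lo (+-monoʳ-≤ (h + h) (n≤1+n 1)))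
                              (independent-chords cP cQ (equal-σ⇒independent P≢Q eq))

  straddle : ∀ {P Q R} → Chord P → Chord Q → Chord R → σ P < σ Q → σ R ≢ σ P → σ R ≢ σ Q →
             h + h + 2 + lo ≤ hi
  straddle {P} {Q} {R} cP cQ cR P<Q R≢P R≢Q with <-cmp (σ R) (σ P) | <-cmp (σ R) (σ Q)
  ... | tri< R<P _ _ | _            = spread 2 cR cQ (2+a≤c R<P P<Q)
  ... | tri> _ _ P<R | tri< R<Q _ _ = spread 2 cP cQ (2+a≤c P<R R<Q)
  ... | tri> _ _ _   | tri> _ _ Q<R = spread 2 cP cR (2+a≤c P<Q Q<R)
  ... | tri≈ _ e _   | _            = ⊥-elim (R≢P e)
  ... | _            | tri≈ _ e _   = ⊥-elim (R≢Q e)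

  -- Chords with equal sums are independent, and pairwise different sums spread by at least 2.
  three-chords : ∀ {P Q R} → Chord P → Chord Q → Chord R → P ≢ Q → P ≢ R → Q ≢ R →
                 h + h + 2 + lo ≤ hi
  three-chords {P} {Q} {R} cP cQ cR P≢Q P≢R Q≢R with σ P ≟ σ Q | σ P ≟ σ R | σ Q ≟ σ R
  ... | yes e | _     | _     = independent-chords cP cQ (equal-σ⇒independent P≢Q e)
  ... | no _  | yes e | _     = independent-chords cP cR (equal-σ⇒independent P≢R e)
  ... | no _  | no _  | yes e = independent-chords cQ cR (equal-σ⇒independent Q≢R e)
  ... | no σP≢σQ | no σP≢σR | no σQ≢σR with <-cmp (σ P) (σ Q)
  ...   | tri< P<Q _ _ = straddle cP cQ cR P<Q (σP≢σR ∘ sym) (σQ≢σR ∘ sym)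
  ...   | tri> _ _ Q<P = straddle cQ cP cR Q<P (σQ≢σR ∘ sym) (σP≢σR ∘ sym)
  ...   | tri≈ _ e _   = ⊥-elim (σP≢σQ e)

-- Lists and walks

at : ∀ {A : Set} → A → List A → ℕ → A
at d []       _       = d
at d (v ∷ vs) zero    = v
at d (v ∷ vs) (suc i) = at d vs i

module _ {A : Set} (d : A) where

  at-∈ : ∀ xs {i} → i < length xs → at d xs i ∈ xs
  at-∈ (v ∷ vs) {zero}  _       = here refl
  at-∈ (v ∷ vs) {suc i} (s≤s l) = there (at-∈ vs l)

  at-length : ∀ xs → at d xs (length xs) ≡ d
  at-length []       = refl
  at-length (v ∷ vs) = at-length vs

  at-lookup : ∀ xs (k : Fin (length xs)) → at d xs (toℕ k) ≡ lookup xs k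
  at-lookup (v ∷ vs) fzero    = refl
  at-lookup (v ∷ vs) (fsuc k) = at-lookup vs k

  at-injective : ∀ {xs i j} → Unique xs → i < length xs → j < length xs →
                 at d xs i ≡ at d xs j → i ≡ j
  at-injective {_ ∷ _}  {zero}  {zero}  _ _ _ _ = refl
  at-injective {_ ∷ vs} {zero}  {suc j} (v∉ ∷ _) _ (s≤s l) eq =
    ⊥-elim (All.lookup v∉ (at-∈ vs l) eq)
  at-injective {_ ∷ vs} {suc i} {zero}  (v∉ ∷ _) (s≤s l) _ eq =
    ⊥-elim (All.lookup v∉ (at-∈ vs l) (sym eq))
  at-injective {_ ∷ _}  {suc i} {suc j} (_ ∷ u) (s≤s l) (s≤s l′) eq =
    cong suc (at-injective u l l′ eq)

  -- Reading past the end of xs yields d, which stands for the last element of xs ++ [ d ].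
  at-linked : ∀ {R : A → A → Set} {xs i} → Linked R (xs ++ [ d ]) → i < length xs →
              R (at d xs i) (at d xs (suc i))
  at-linked {xs = _ ∷ []}    {zero}  (r ∷ _) _        = r
  at-linked {xs = _ ∷ []}    {suc i} _       (s≤s ())
  at-linked {xs = _ ∷ _ ∷ _} {zero}  (r ∷ _) _        = r
  at-linked {xs = _ ∷ _ ∷ _} {suc i} (_ ∷ l) (s≤s lt) = at-linked l lt

module _ {A : Set} where

  open Perm (setoid A) using (↭-sym)
  open PermProps (setoid A) using (Unique-resp-↭; ↭-reverse; ∷↭∷ʳ)

  Unique-reverse : ∀ {xs : List A} → Unique xs → Unique (reverse xs)
  Unique-reverse {xs} = Unique-resp-↭ (↭-sym (↭-reverse xs))

  Unique-∷ʳ⇒∷ : ∀ {x : A} xs → Unique (xs ∷ʳ x) → Unique (x ∷ xs)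
  Unique-∷ʳ⇒∷ {x} xs = Unique-resp-↭ (↭-sym (∷↭∷ʳ x xs))

  Unique-∷ʳ⁻ : ∀ {w : A} xs → Unique (xs ∷ʳ w) → Unique xs × w ∉ xs
  Unique-∷ʳ⁻ []       _        = [] , λ ()
  Unique-∷ʳ⁻ (x ∷ xs) (x≢ ∷ u) with Unique-∷ʳ⁻ xs u
  ... | u′ , w∉xs = All.++⁻ˡ xs x≢ ∷ u′ , λ where
    (here refl) → All.head (All.++⁻ʳ xs x≢) refl
    (there p)   → w∉xs p

-- Walk G a b xs : a walk from a to b whose vertices after a are xs.
data Walk {n : ℕ} (G : SimpleGraph n) : Fin n → Fin n → List (Fin n) → Set where
  []  : ∀ {a} → Walk G a a []
  _∷_ : ∀ {a b c xs} → Adj G a b → Walk G b c xs → Walk G a c (b ∷ xs)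

module _ {n : ℕ} {G : SimpleGraph n} where

  infixr 5 _++ʷ_

  _++ʷ_ : ∀ {a b c xs ys} → Walk G a b xs → Walk G b c ys → Walk G a c (xs ++ ys)
  []      ++ʷ w′ = w′
  (e ∷ w) ++ʷ w′ = e ∷ (w ++ʷ w′)

  walk⇒linked : ∀ {a b xs} → Walk G a b xs → Linked (Adj G) (a ∷ xs)
  walk⇒linked []           = [-]
  walk⇒linked (e ∷ [])     = e ∷ [-]
  walk⇒linked (e ∷ e′ ∷ w) = e ∷ walk⇒linked (e′ ∷ w)

  linked⇒walk : ∀ {a b xs} → Linked (Adj G) (a ∷ xs) → last (a ∷ xs) ≡ just b → Walk G a b xs
  linked⇒walk {xs = []}    [-]     eq = subst (λ b → Walk G _ b []) (just-injective eq) []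
  linked⇒walk {xs = _ ∷ _} (e ∷ l) eq = e ∷ linked⇒walk l eq

  walk-∷ʳ-end : ∀ {a b c} xs → Walk G a b (xs ∷ʳ c) → c ≡ b
  walk-∷ʳ-end []       (_ ∷ []) = refl
  walk-∷ʳ-end (_ ∷ xs) (_ ∷ w)  = walk-∷ʳ-end xs w

  unsnoc-walk : ∀ {a b} mid → Walk G a b (mid ∷ʳ b) → ∃[ u ] Walk G a u mid × Adj G u b
  unsnoc-walk []        (e ∷ []) = _ , [] , e
  unsnoc-walk (_ ∷ mid) (e ∷ w)  with unsnoc-walk mid w
  ... | u , w′ , e′ = u , e ∷ w′ , e′

  reverse-walk : ∀ {a b} mid → Walk G a b (mid ∷ʳ b) → Walk G b a (reverse mid ∷ʳ a)
  reverse-walk []              (e ∷ []) = Adj-sym G e ∷ []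
  reverse-walk {a} {b} (c ∷ mid) (e ∷ w) =
    subst (Walk G b a) (cong (_∷ʳ a) (sym (unfold-reverse c mid)))
      (reverse-walk mid w ++ʷ (Adj-sym G e ∷ []))

  closedWalk⇒cycle : ∀ {c xs} → Walk G c c xs → Unique xs → 3 ≤ length xs →
                     ∃[ ds ] IsCycle G ds × length ds ≡ length xs
  closedWalk⇒cycle {c} {xs} w u 3≤len with initLast xs
  ... | ys ∷ʳ′ _ with walk-∷ʳ-end ys w
  ... | refl =
    c ∷ ys , (≤-trans 3≤len (≤-reflexive length-snoc) , Unique-∷ʳ⇒∷ ys u , c , ys , refl , walk⇒linked w) ,
    sym length-snoc
    where
    length-snoc : length (ys ∷ʳ c) ≡ suc (length ys)
    length-snoc = trans (length-++ ys) (+-comm (length ys) 1)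

  split-path : ∀ {z w L} → Unique L → Linked (Adj G) L → head L ≡ just z → last L ≡ just w →
    z ≢ w → ∃[ mid ] L ≡ z ∷ mid ∷ʳ w × Walk G z w (mid ∷ʳ w) × Unique mid × z ∉ mid × w ∉ mid
  split-path {L = z ∷ T} (z∉T ∷ u) l refl lst z≢w with initLast T
  ... | []         = ⊥-elim (z≢w (just-injective lst))
  ... | mid ∷ʳ′ w′ with walk-∷ʳ-end mid (linked⇒walk l lst)
  ... | refl with Unique-∷ʳ⁻ mid u
  ...   | u′ , w∉mid =
    mid , refl , linked⇒walk l lst , u′ , (λ p → All.lookup z∉T (∈-++⁺ˡ p) refl) , w∉mid

-- Indexing a cycle by ℕ

module CycleIndexing {n : ℕ} (G : SimpleGraph n) (c₀ : Fin n) (rest : List (Fin n))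
  (cs-unique : Unique (c₀ ∷ rest)) (cs-linked : Linked (Adj G) ((c₀ ∷ rest) ++ [ c₀ ])) where

  m : ℕ
  m = suc (length rest)

  entry : ℕ → Fin n
  entry = at c₀ (c₀ ∷ rest)

  C[_] : ℕ → Fin n
  C[ t ] = entry (t % m)

  C-∈ : ∀ t → C[ t ] ∈ c₀ ∷ rest
  C-∈ t = at-∈ c₀ (c₀ ∷ rest) (m%n<n t m)

  C-lookup : ∀ k → C[ toℕ k ] ≡ lookup (c₀ ∷ rest) k
  C-lookup k = trans (cong entry (m<n⇒m%n≡m (toℕ<n k))) (at-lookup c₀ (c₀ ∷ rest) k)

  C-periodic : ∀ t → C[ t + m ] ≡ C[ t ]
  C-periodic t = cong entry ([m+n]%n≡m%n t m)

  -- Position m lies past the end of c₀ ∷ rest and is read as the default c₀, like position 0.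
  entry-% : ∀ {k} → k ≤ m → entry (k % m) ≡ entry k
  entry-% k≤m with m≤n⇒m<n∨m≡n k≤m
  ... | inj₁ k<m  = cong entry (m<n⇒m%n≡m k<m)
  ... | inj₂ refl = trans (cong entry (n%n≡0 m)) (sym (at-length c₀ rest))

  C-step : ∀ t → Adj G C[ t ] C[ suc t ]
  C-step t = subst (Adj G C[ t ]) (sym C[1+t]) (at-linked c₀ cs-linked (m%n<n t m))
    where
    open ≡-Reasoning
    C[1+t] : C[ suc t ] ≡ entry (suc (t % m))
    C[1+t] = begin
      entry (suc t % m)                      ≡⟨ cong (λ k → entry (suc k % m)) (m≡m%n+[m/n]*n t m) ⟩
      entry ((suc (t % m) + t / m * m) % m)  ≡⟨ cong entry ([m+kn]%n≡m%n (suc (t % m)) (t / m) m) ⟩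
      entry (suc (t % m) % m)                ≡⟨ entry-% (m%n<n t m) ⟩
      entry (suc (t % m))                    ∎

  C-distinct : ∀ {i j} → i < j → j < i + m → C[ i ] ≢ C[ j ]
  C-distinct {i} i<j j<i+m eq with ≤⇒gap (<⇒≤ i<j)
  ... | d , refl = <-irrefl (sym (+-identityʳ i)) (subst (λ d → i < i + d) d≡0 i<j)
    where
    d≡0 : d ≡ 0
    d≡0 = [i+d]%m≡i%m⇒d≡0 m i d (+-cancelˡ-< i d m j<i+m)
            (sym (at-injective c₀ cs-unique (m%n<n i m) (m%n<n (i + d) m) eq))

  up : ℕ → ℕ → List (Fin n)
  up i zero    = C[ i ] ∷ []
  up i (suc k) = C[ i ] ∷ up (suc i) k

  down : ℕ → ℕ → List (Fin n)
  down i zero    = C[ i ] ∷ []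
  down i (suc k) = C[ i + suc k ] ∷ down i k

  up-walk : ∀ {a} i k → Adj G a C[ i ] → Walk G a C[ i + k ] (up i k)
  up-walk {a} i zero    e = subst (λ t → Walk G a C[ t ] (up i 0)) (sym (+-identityʳ i)) (e ∷ [])
  up-walk     i (suc k) e =
    e ∷ subst (λ t → Walk G C[ i ] C[ t ] (up (suc i) k)) (sym (+-suc i k)) (up-walk (suc i) k (C-step i))

  down-walk : ∀ {a} i k → Adj G a C[ i + k ] → Walk G a C[ i ] (down i k)
  down-walk {a} i zero    e = subst (λ t → Adj G a C[ t ]) (+-identityʳ i) e ∷ []
  down-walk     i (suc k) e =
    e ∷ down-walk i k (subst (λ t → Adj G C[ t ] C[ i + k ]) (sym (+-suc i k)) (Adj-sym G (C-step (i + k))))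

  ∈-up⁻ : ∀ {v} i k → v ∈ up i k → ∃[ t ] t ≤ k × C[ i + t ] ≡ v
  ∈-up⁻ i zero    (here refl) = 0 , z≤n , cong C[_] (+-identityʳ i)
  ∈-up⁻ i (suc k) (here refl) = 0 , z≤n , cong C[_] (+-identityʳ i)
  ∈-up⁻ i (suc k) (there p) with ∈-up⁻ (suc i) k p
  ... | t , t≤k , eq = suc t , s≤s t≤k , trans (cong C[_] (+-suc i t)) eq

  ∈-down⁻ : ∀ {v} i k → v ∈ down i k → ∃[ t ] t ≤ k × C[ i + t ] ≡ v
  ∈-down⁻ i zero    (here refl) = 0 , z≤n , cong C[_] (+-identityʳ i)
  ∈-down⁻ i (suc k) (here refl) = suc k , ≤-refl , refl
  ∈-down⁻ i (suc k) (there p) with ∈-down⁻ i k p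
  ... | t , t≤k , eq = t , m≤n⇒m≤1+n t≤k , eq

  up-unique : ∀ i k → k < m → Unique (up i k)
  up-unique i zero    _   = [] ∷ []
  up-unique i (suc k) k<m = tabulate fresh ∷ up-unique (suc i) k (<-trans (n<1+n k) k<m)
    where
    fresh : ∀ {v} → v ∈ up (suc i) k → C[ i ] ≢ v
    fresh p with ∈-up⁻ (suc i) k p
    ... | t , t≤k , refl = C-distinct {i} {suc i + t} (s≤s (m≤m+n i t))
                             (subst (_< i + m) (+-suc i t) (+-monoʳ-< i (<-≤-trans (s≤s (s≤s t≤k)) k<m)))

  down-unique : ∀ i k → k < m → Unique (down i k)
  down-unique i zero    _   = [] ∷ []
  down-unique i (suc k) k<m = tabulate fresh ∷ down-unique i k (<-trans (n<1+n k) k<m)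
    where
    fresh : ∀ {v} → v ∈ down i k → C[ i + suc k ] ≢ v
    fresh p eq with ∈-down⁻ i k p
    ... | t , t≤k , refl = C-distinct {i + t} {i + suc k} (+-monoʳ-< i (s≤s t≤k))
                             (≤-trans (+-monoʳ-< i (<-≤-trans k<m (m≤n+m m t)))
                                      (≤-reflexive (sym (+-assoc i t m))))
                             (sym eq)

  length-up : ∀ i k → length (up i k) ≡ suc k
  length-up i zero    = refl
  length-up i (suc k) = cong suc (length-up (suc i) k)

  length-down : ∀ i k → length (down i k) ≡ suc k
  length-down i zero    = refl
  length-down i (suc k) = cong suc (length-down i k)

  record Arc (i k : ℕ) (xs : List (Fin n)) : Set where
    field
      on-arc  : ∀ {v} → v ∈ xs → ∃[ t ] t ≤ k × C[ i + t ] ≡ v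
      unique  : k < m → Unique xs
      length≡ : length xs ≡ suc k

  up-arc : ∀ i k → Arc i k (up i k)
  up-arc i k = record { on-arc = ∈-up⁻ i k ; unique = up-unique i k ; length≡ = length-up i k }

  down-arc : ∀ i k → Arc i k (down i k)
  down-arc i k = record { on-arc = ∈-down⁻ i k ; unique = down-unique i k ; length≡ = length-down i k }

  short-arcs : ∀ {i k j l} → i + k < j → j + l < i + m → k < m × l < m
  short-arcs {i} {k} {j} {l} i+k<j j+l<i+m =
    +-cancelˡ-< i k m (<-trans i+k<j (≤-<-trans (m≤m+n j l) j+l<i+m)) ,
    +-cancelˡ-< j l m (<-≤-trans j+l<i+m (+-monoˡ-≤ m (≤-trans (m≤m+n i k) (<⇒≤ i+k<j))))

  arcs-disjoint : ∀ {i k j l xs ys} → Arc i k xs → Arc j l ys → i + k < j → j + l < i + m →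
                  Disjoint xs ys
  arcs-disjoint {i} {k} {j} {l} X Y i+k<j j+l<i+m (p , q) with Arc.on-arc X p | Arc.on-arc Y q
  ... | t , t≤k , refl | t′ , t′≤l , eq = C-distinct {i + t} {j + t′} before wrap (sym eq)
    where
    before : i + t < j + t′
    before = <-≤-trans (≤-<-trans (+-monoʳ-≤ i t≤k) i+k<j) (m≤m+n j t′)
    wrap : j + t′ < i + t + m
    wrap = <-≤-trans (≤-<-trans (+-monoʳ-≤ j t′≤l) j+l<i+m) (+-monoˡ-≤ m (m≤m+n i t))

  arc-offC-disjoint : ∀ {i k xs ys} → Arc i k xs → (∀ {v} → v ∈ ys → v ∉ c₀ ∷ rest) →
                      Disjoint xs ys
  arc-offC-disjoint {i} X off (p , q) with Arc.on-arc X p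
  ... | t , _ , refl = off q (C-∈ (i + t))

  arc-nonempty : ∀ {i k xs} → Arc i k xs → 1 ≤ length xs
  arc-nonempty X = subst (1 ≤_) (sym (Arc.length≡ X)) (s≤s z≤n)

  module Longest (longest : ∀ ds → IsCycle G ds → length ds ≤ m) where

    closedWalk-length : ∀ {v xs} → Walk G v v xs → Unique xs → 3 ≤ length xs → length xs ≤ m
    closedWalk-length w u 3≤len with closedWalk⇒cycle w u 3≤len
    ... | ds , cycle , eq = subst (_≤ m) eq (longest ds cycle)

    four-piece-length : ∀ {v X Y Z W} → Walk G v v (X ++ Y ++ Z ++ W) →
      All Unique (X ∷ Y ∷ Z ∷ W ∷ []) → AllPairs Disjoint (X ∷ Y ∷ Z ∷ W ∷ []) →
      1 ≤ length X → 1 ≤ length Z → 1 ≤ length W →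
      length X + (length Y + (length Z + length W)) ≤ m
    four-piece-length {X = X} {Y} {Z} {W} w uniques disjoint X≢[] Z≢[] W≢[] =
      subst (_≤ m) lengths (closedWalk-length w unique (subst (3 ≤_) (sym lengths) three))
      where
      unique : Unique (X ++ Y ++ Z ++ W)
      unique = subst (λ R → Unique (X ++ Y ++ Z ++ R)) (++-identityʳ W) (Unique.concat⁺ uniques disjoint)
      lengths : length (X ++ Y ++ Z ++ W) ≡ length X + (length Y + (length Z + length W))
      lengths = trans (length-++ X) (cong (length X +_) (trans (length-++ Y) (cong (length Y +_) (length-++ Z))))
      three : 3 ≤ length X + (length Y + (length Z + length W))
      three = +-mono-≤ X≢[] (≤-trans (+-mono-≤ Z≢[] W≢[]) (m≤n+m _ (length Y)))

    module OutsidePath {ps : List (Fin n)} {x y : Fin n}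
      (P-walk : ∀ {a} → Adj G a x → Walk G a y ps) (P-unique : Unique ps)
      (P-offC : ∀ {v} → v ∈ ps → v ∉ c₀ ∷ rest) (P-nonempty : 1 ≤ length ps) where

      record Detour (a b : Fin n) (mid : List (Fin n)) : Set where
        field
          walk   : Walk G a b (mid ∷ʳ b)
          unique : Unique mid
          offC   : ∀ {v} → v ∈ mid → v ∉ c₀ ∷ rest
          offP   : Disjoint mid ps

      edge-detour : ∀ {a b} → Adj G a b → Detour a b []
      edge-detour e = record { walk = e ∷ [] ; unique = [] ; offC = λ () ; offP = λ () }

      reverse-detour : ∀ {a b mid} → Detour a b mid → Detour b a (reverse mid)
      reverse-detour {mid = mid} D = record
        { walk   = reverse-walk mid walk
        ; unique = Unique-reverse unique
        ; offC   = offC ∘ Any.reverse⁻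
        ; offP   = λ (p , q) → offP (Any.reverse⁻ p , q)
        }
        where open Detour D

      arcs-around-detour : ∀ {i k j l a b X mid Z} → Arc i k X → Arc j l Z → i + k < j → j + l < i + m →
        Detour a b mid → Walk G y y (X ++ mid ++ Z ++ ps) →
        suc k + (length mid + (suc l + length ps)) ≤ m
      arcs-around-detour {i} {k} {j} {l} {X = xs} {mid} {zs} X Z i+k<j j+l<i+m D cycle =
        subst (_≤ m) (cong₂ _+_ (Arc.length≡ X) (cong (length mid +_) (cong (_+ length ps) (Arc.length≡ Z))))
          (four-piece-length cycle uniques disjoint (arc-nonempty X) (arc-nonempty Z) P-nonempty)
        where
        open Detour D
        uniques : All Unique (xs ∷ mid ∷ zs ∷ ps ∷ [])
        uniques = Arc.unique X (proj₁ (short-arcs i+k<j j+l<i+m)) ∷ unique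
                ∷ Arc.unique Z (proj₂ (short-arcs i+k<j j+l<i+m)) ∷ P-unique ∷ []
        disjoint : AllPairs Disjoint (xs ∷ mid ∷ zs ∷ ps ∷ [])
        disjoint = (arc-offC-disjoint X offC ∷ arcs-disjoint X Z i+k<j j+l<i+m
                      ∷ arc-offC-disjoint X P-offC ∷ [])
                 ∷ (Disjoint.sym (arc-offC-disjoint Z offC) ∷ offP ∷ [])
                 ∷ (arc-offC-disjoint Z P-offC ∷ [])
                 ∷ [] ∷ []

      arcs-around-chords : ∀ {i k j l r s X Y Z} → Arc i k X → Arc j l Y → Arc r s Z →
        i + k < r → r + s < j → j + l < i + m → Walk G y y (X ++ Y ++ Z ++ ps) →
        suc k + (suc l + (suc s + length ps)) ≤ m
      arcs-around-chords {i} {k} {j} {l} {r} {s} {xs} {ys} {zs} X Y Z i+k<r r+s<j j+l<i+m cycle =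
        subst (_≤ m)
          (cong₂ _+_ (Arc.length≡ X) (cong₂ _+_ (Arc.length≡ Y) (cong (_+ length ps) (Arc.length≡ Z))))
          (four-piece-length cycle uniques disjoint (arc-nonempty X) (arc-nonempty Z) P-nonempty)
        where
        i+k<j : i + k < j
        i+k<j = <-trans i+k<r (≤-<-trans (m≤m+n r s) r+s<j)
        r+s<i+m : r + s < i + m
        r+s<i+m = <-trans r+s<j (≤-<-trans (m≤m+n j l) j+l<i+m)
        j+l<r+m : j + l < r + m
        j+l<r+m = <-≤-trans j+l<i+m (+-monoˡ-≤ m (≤-trans (m≤m+n i k) (<⇒≤ i+k<r)))
        uniques : All Unique (xs ∷ ys ∷ zs ∷ ps ∷ [])
        uniques = Arc.unique X (proj₁ (short-arcs i+k<j j+l<i+m))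
                ∷ Arc.unique Y (proj₂ (short-arcs i+k<j j+l<i+m))
                ∷ Arc.unique Z (proj₁ (short-arcs r+s<j j+l<r+m)) ∷ P-unique ∷ []
        disjoint : AllPairs Disjoint (xs ∷ ys ∷ zs ∷ ps ∷ [])
        disjoint = (arcs-disjoint X Y i+k<j j+l<i+m ∷ arcs-disjoint X Z i+k<r r+s<i+m
                      ∷ arc-offC-disjoint X P-offC ∷ [])
                 ∷ (Disjoint.sym (arcs-disjoint Z Y r+s<j j+l<r+m) ∷ arc-offC-disjoint Y P-offC ∷ [])
                 ∷ (arc-offC-disjoint Z P-offC ∷ [])
                 ∷ [] ∷ []

      detour-forward : ∀ {z b w e mid} → z ≤ b → b < w → w ≤ e → e < z + m →
        Adj G y C[ b ] → Detour C[ z ] C[ w ] mid → Adj G x C[ e ] →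
        length ps + (length mid + 2) + (b + e) ≤ z + w + m
      detour-forward {z} {w = w} {mid = mid} z≤b b<w w≤e e<z+m yb D xe
        with ≤⇒gap z≤b | ≤⇒gap w≤e | unsnoc-walk mid (Detour.walk D)
      ... | k₁ , refl | k₂ , refl | _ , mid-walk , last-edge =
        subst (_≤ z + w + m) (rearrange z w k₁ k₂ (length mid) (length ps))
          (+-monoʳ-≤ (z + w) (arcs-around-detour (down-arc z k₁) (up-arc w k₂) b<w e<z+m D
            (down-walk z k₁ yb ++ʷ mid-walk ++ʷ up-walk w k₂ last-edge ++ʷ P-walk (Adj-sym G xe))))
        where
        rearrange : ∀ z w k₁ k₂ l q → z + w + (suc k₁ + (l + (suc k₂ + q)))
                                    ≡ q + (l + 2) + (z + k₁ + (w + k₂))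
        rearrange = solve-∀

      detour-backward : ∀ {a w p z′ mid} → a ≤ w → w < p → p ≤ z′ → z′ < a + m →
        Adj G y C[ a ] → Detour C[ w ] C[ z′ ] mid → Adj G x C[ p ] →
        length ps + (length mid + 2) + (w + z′) ≤ a + p + m
      detour-backward {a} {p = p} {mid = mid} a≤w w<p p≤z′ z′<a+m ya D xp
        with ≤⇒gap a≤w | ≤⇒gap p≤z′ | unsnoc-walk mid (Detour.walk D)
      ... | k₁ , refl | k₂ , refl | _ , mid-walk , last-edge =
        subst (_≤ a + p + m) (rearrange a p k₁ k₂ (length mid) (length ps))
          (+-monoʳ-≤ (a + p) (arcs-around-detour (up-arc a k₁) (down-arc p k₂) w<p z′<a+m D
            (up-walk a k₁ ya ++ʷ mid-walk ++ʷ down-walk p k₂ last-edge ++ʷ P-walk (Adj-sym G xp))))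
        where
        rearrange : ∀ a p k₁ k₂ l q → a + p + (suc k₁ + (l + (suc k₂ + q)))
                                    ≡ q + (l + 2) + (a + k₁ + (p + k₂))
        rearrange = solve-∀

      chords-cycle : ∀ {α β γ δ ε ζ} → α ≤ β → β < ε → ε ≤ ζ → ζ < δ → δ ≤ γ → γ < α + m →
        Adj G y C[ α ] → Adj G C[ β ] C[ γ ] → Adj G C[ δ ] C[ ε ] → Adj G x C[ ζ ] →
        length ps + 3 + (β + γ + ζ) ≤ α + δ + ε + m
      chords-cycle {α} {δ = δ} {ε} α≤β β<ε ε≤ζ ζ<δ δ≤γ γ<α+m yα βγ δε xζ
        with ≤⇒gap α≤β | ≤⇒gap δ≤γ | ≤⇒gap ε≤ζ
      ... | k₁ , refl | k₂ , refl | k₃ , refl =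
        subst (_≤ α + δ + ε + m) (rearrange α δ ε k₁ k₂ k₃ (length ps))
          (+-monoʳ-≤ (α + δ + ε) (arcs-around-chords (up-arc α k₁) (down-arc δ k₂) (up-arc ε k₃)
            β<ε ζ<δ γ<α+m (up-walk α k₁ yα ++ʷ down-walk δ k₂ βγ ++ʷ up-walk ε k₃ δε ++ʷ P-walk (Adj-sym G xζ))))
        where
        rearrange : ∀ α δ ε k₁ k₂ k₃ q → α + δ + ε + (suc k₁ + (suc k₂ + (suc k₃ + q)))
                                       ≡ q + 3 + (α + k₁ + (δ + k₂) + (ε + k₃))
        rearrange = solve-∀

      -- Positions p₀ ≤ p₁ ≤ p₂ < p₃ ≤ p₀ + m of ξ_a, ξ_{a+1}, ξ_b, ξ_{b+1}.
      module Segments (p₀ p₁ p₂ p₃ : ℕ) (p₁≤p₂ : p₁ ≤ p₂) (p₃≤p₀+m : p₃ ≤ p₀ + m)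
        (x₀ : Adj G x C[ p₀ ]) (y₁ : Adj G y C[ p₁ ]) (x₂ : Adj G x C[ p₂ ]) (y₂ : Adj G y C[ p₂ ])
        (x₃ : Adj G x C[ p₃ ]) (y₃ : Adj G y C[ p₃ ]) where

        Inside : ℕ → ℕ → ℕ → Set
        Inside a b t = a < t × t < b

        interiors-distinct : ∀ {z w} → Inside p₀ p₁ z → Inside p₂ p₃ w → C[ z ] ≢ C[ w ]
        interiors-distinct (p₀<z , z<p₁) (p₂<w , w<p₃) =
          C-distinct (<-trans z<p₁ (≤-<-trans p₁≤p₂ p₂<w))
                     (<-≤-trans w<p₃ (≤-trans p₃≤p₀+m (+-monoˡ-≤ m (<⇒≤ p₀<z))))

        intermediate-bound : ∀ {z w mid} → Inside p₀ p₁ z → Inside p₂ p₃ w →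
          Detour C[ z ] C[ w ] mid →
          length ps + (length mid + 2) + (p₂ + p₀) ≤ z + w
          × length ps + (length mid + 2) + (z + w) ≤ p₁ + p₃
        intermediate-bound {z} {w} {mid} (p₀<z , z<p₁) (p₂<w , w<p₃) D = forward , backward
          where
          h : ℕ
          h = length ps + (length mid + 2)
          regroup : ∀ h a b m → h + (a + (b + m)) ≡ h + (a + b) + m
          regroup = solve-∀
          shuffle : ∀ h a b m → h + (b + (a + m)) ≡ h + (a + b) + m
          shuffle = solve-∀
          forward : h + (p₂ + p₀) ≤ z + w
          forward = +-cancelʳ-≤ m _ _ (subst (_≤ z + w + m) (regroup h p₂ p₀ m)
            (detour-forward (<⇒≤ (<-≤-trans z<p₁ p₁≤p₂)) p₂<w (<⇒≤ (<-≤-trans w<p₃ p₃≤p₀+m))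
              (+-monoˡ-< m p₀<z) y₂ D (subst (Adj G x) (sym (C-periodic p₀)) x₀)))
          backward : h + (z + w) ≤ p₁ + p₃
          backward = +-cancelʳ-≤ m _ _ (subst (_≤ p₁ + p₃ + m)
            (trans (cong (λ l → length ps + (l + 2) + (w + (z + m))) (length-reverse mid)) (shuffle h z w m))
            (detour-backward (≤-trans p₁≤p₂ (<⇒≤ p₂<w)) w<p₃
              (≤-trans p₃≤p₀+m (<⇒≤ (+-monoˡ-< m p₀<z))) (+-monoˡ-< m z<p₁) y₁
              (subst (λ c → Detour C[ w ] c (reverse mid)) (sym (C-periodic z)) (reverse-detour D)) x₃))

        Chord : ℕ × ℕ → Set
        Chord (z , w) = Inside p₀ p₁ z × Inside p₂ p₃ w × Adj G C[ z ] C[ w ]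

        chord-bound : ∀ {P} → Chord P →
          length ps + 2 + (p₂ + p₀) ≤ σ P × length ps + 2 + σ P ≤ p₁ + p₃
        chord-bound (z∈a , w∈b , e) = intermediate-bound z∈a w∈b (edge-detour e)

        -- The two cycles of chords-cycle, shifted by m so that their positions are increasing.
        crossing-chords : ∀ {z₁ w₁ z₂ w₂} → Chord (z₁ , w₁) → Chord (z₂ , w₂) → z₁ < z₂ → w₂ < w₁ →
          length ps + 2 + (length ps + 2) + 2 + (p₂ + p₀) ≤ p₁ + p₃
        crossing-chords {z₁} {w₁} {z₂} {w₂}
          ((p₀<z₁ , _) , (_ , w₁<p₃) , e₁) ((_ , z₂<p₁) , (p₂<w₂ , _) , e₂) z₁<z₂ w₂<w₁ =
          +-cancelʳ-≤ K _ _
            (subst₂ _≤_ (lhs (length ps) z₁ w₁ z₂ w₂ p₀ p₂ m) (rhs z₁ w₁ z₂ w₂ p₁ p₃ m)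
              (+-mono-≤ through-ξb⁺ through-ξa⁺))
          where
          K : ℕ
          K = z₁ + w₁ + z₂ + w₂ + (m + m + m + m + m)
          through-ξb⁺ : length ps + 3 + ((z₁ + m) + (w₁ + m) + (p₂ + m))
                      ≤ p₃ + (w₂ + m) + (z₂ + m) + m
          through-ξb⁺ = chords-cycle
            (≤-trans p₃≤p₀+m (<⇒≤ (+-monoˡ-< m p₀<z₁))) (+-monoˡ-< m z₁<z₂)
            (+-monoˡ-≤ m (<⇒≤ (<-≤-trans z₂<p₁ p₁≤p₂))) (+-monoˡ-< m p₂<w₂)
            (+-monoˡ-≤ m (<⇒≤ w₂<w₁)) (+-monoˡ-< m w₁<p₃)
            y₃ (subst₂ (Adj G) (sym (C-periodic z₁)) (sym (C-periodic w₁)) e₁)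
            (subst₂ (Adj G) (sym (C-periodic w₂)) (sym (C-periodic z₂)) (Adj-sym G e₂))
            (subst (Adj G x) (sym (C-periodic p₂)) x₂)
          through-ξa⁺ : length ps + 3 + (w₂ + (z₂ + m) + (p₀ + m)) ≤ p₁ + (z₁ + m) + w₁ + m
          through-ξa⁺ = chords-cycle
            (≤-trans p₁≤p₂ (<⇒≤ p₂<w₂)) w₂<w₁ (<⇒≤ (<-≤-trans w₁<p₃ p₃≤p₀+m))
            (+-monoˡ-< m p₀<z₁) (+-monoˡ-≤ m (<⇒≤ z₁<z₂)) (+-monoˡ-< m z₂<p₁)
            y₁ (subst (Adj G C[ w₂ ]) (sym (C-periodic z₂)) (Adj-sym G e₂))
            (subst (λ c → Adj G c C[ w₁ ]) (sym (C-periodic z₁)) e₁)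
            (subst (Adj G x) (sym (C-periodic p₀)) x₀)
          lhs : ∀ l z₁ w₁ z₂ w₂ p₀ p₂ m →
                l + 3 + (z₁ + m + (w₁ + m) + (p₂ + m)) + (l + 3 + (w₂ + (z₂ + m) + (p₀ + m)))
              ≡ l + 2 + (l + 2) + 2 + (p₂ + p₀) + (z₁ + w₁ + z₂ + w₂ + (m + m + m + m + m))
          lhs = solve-∀
          rhs : ∀ z₁ w₁ z₂ w₂ p₁ p₃ m →
                p₃ + (w₂ + m) + (z₂ + m) + m + (p₁ + (z₁ + m) + w₁ + m)
              ≡ p₁ + p₃ + (z₁ + w₁ + z₂ + w₂ + (m + m + m + m + m))
          rhs = solve-∀

-- Elementary segments and intermediate paths

module Configuration {n : ℕ} (G : SimpleGraph n) {c₀ : Fin n} {rest : List (Fin n)}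
  (cs-unique : Unique (c₀ ∷ rest)) (cs-linked : Linked (Adj G) ((c₀ ∷ rest) ++ [ c₀ ]))
  (longest : ∀ ds → IsCycle G ds → length ds ≤ length (c₀ ∷ rest))
  {x y : Fin n} {ps′ : List (Fin n)} (P-walk : Walk G x y ps′) (P-unique : Unique (x ∷ ps′))
  (P-offC : ∀ v → v ∈ x ∷ ps′ → v ∉ c₀ ∷ rest)
  (same-neighbours : ∀ v → v ∈ c₀ ∷ rest → (Adj G x v ⇔ Adj G y v))
  {pa qa pb qb : Fin (length (c₀ ∷ rest))}
  (pa-in : InN G (c₀ ∷ rest) x y (lookup (c₀ ∷ rest) pa))
  (qa-in : InN G (c₀ ∷ rest) x y (lookup (c₀ ∷ rest) qa))
  (between-a : ∀ k → StrictlyBetween G (c₀ ∷ rest) x y pa qa k →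
               ¬ InN G (c₀ ∷ rest) x y (lookup (c₀ ∷ rest) k))
  (pb-in : InN G (c₀ ∷ rest) x y (lookup (c₀ ∷ rest) pb))
  (qb-in : InN G (c₀ ∷ rest) x y (lookup (c₀ ∷ rest) qb))
  (between-b : ∀ k → StrictlyBetween G (c₀ ∷ rest) x y pb qb k →
               ¬ InN G (c₀ ∷ rest) x y (lookup (c₀ ∷ rest) k))
  (pa≢pb : pa ≢ pb)
  where

  cs ps : List (Fin n)
  cs = c₀ ∷ rest
  ps = x ∷ ps′

  open CycleIndexing G c₀ rest cs-unique cs-linked
  open Longest longest
  open OutsidePath {ps} {x} {y} (_∷ P-walk) P-unique (λ {v} → P-offC v) (s≤s z≤n)

  C-fwd : ∀ {p} k d → p < m → C[ p + fwd m p k + d ] ≡ C[ k + d ]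
  C-fwd {p} k d p<m with fwd-sum k p<m
  ... | inj₁ eq = cong (λ t → C[ t + d ]) eq
  ... | inj₂ eq = trans (cong (λ t → C[ t + d ]) eq)
                        (trans (cong C[_] (+-comm-assoc k m d)) (C-periodic (k + d)))
    where
    +-comm-assoc : ∀ k m d → k + m + d ≡ k + d + m
    +-comm-assoc = solve-∀

  C-fwd-lookup : ∀ {p} (k : Fin m) → p < m → C[ p + fwd m p (toℕ k) ] ≡ lookup cs k
  C-fwd-lookup {p} k p<m =
    trans (cong C[_] (sym (+-identityʳ (p + fwd m p (toℕ k)))))
      (trans (C-fwd (toℕ k) 0 p<m) (trans (cong C[_] (+-identityʳ (toℕ k))) (C-lookup k)))

  both-adjacent : ∀ k t → InN G cs x y (lookup cs k) → C[ t ] ≡ lookup cs k →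
                  Adj G x C[ t ] × Adj G y C[ t ]
  both-adjacent k t k-in eq = subst (λ v → Adj G x v × Adj G y v) (sym eq) (both k-in)
    where
    both : InN G cs x y (lookup cs k) → Adj G x (lookup cs k) × Adj G y (lookup cs k)
    both (inj₁ xk) = xk , Equivalence.to (same-neighbours _ (∈-lookup k)) xk
    both (inj₂ yk) = Equivalence.from (same-neighbours _ (∈-lookup k)) yk , yk

  p₀ A B Ib p₁ p₂ p₃ : ℕ
  p₀ = toℕ pa
  A  = segLen G cs x y pa qa
  B  = fwd m (toℕ pa) (toℕ pb)
  Ib = segLen G cs x y pb qb
  p₁ = p₀ + A
  p₂ = p₀ + B
  p₃ = p₂ + Ib

  p₀<m : p₀ < m
  p₀<m = toℕ<n pa

  A≤B : A ≤ B
  A≤B with A ≤? B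
  ... | yes A≤B = A≤B
  ... | no  A≰B = ⊥-elim (between-a pb (fwd-pos p₀<m (pa≢pb ∘ toℕ-injective) , ≰⇒> A≰B) pb-in)

  B+Ib≤m : B + Ib ≤ m
  B+Ib≤m with B + Ib ≤? m
  ... | yes B+Ib≤m = B+Ib≤m
  ... | no  B+Ib≰m =
    ⊥-elim (between-b pa (fwd-pos (toℕ<n pb) (pa≢pb ∘ sym ∘ toℕ-injective) , back<Ib) pa-in)
    where
    back<Ib : fwd m (toℕ pb) p₀ < Ib
    back<Ib = +-cancelˡ-< B _ Ib (subst (_< B + Ib)
                (sym (fwd-complement p₀<m (toℕ<n pb) (pa≢pb ∘ toℕ-injective))) (≰⇒> B+Ib≰m))

  ξa : Adj G x C[ p₀ ] × Adj G y C[ p₀ ]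
  ξa = both-adjacent pa p₀ pa-in (C-lookup pa)

  ξa⁺ : Adj G x C[ p₁ ] × Adj G y C[ p₁ ]
  ξa⁺ = both-adjacent qa p₁ qa-in (C-fwd-lookup qa p₀<m)

  ξb : Adj G x C[ p₂ ] × Adj G y C[ p₂ ]
  ξb = both-adjacent pb p₂ pb-in (C-fwd-lookup pb p₀<m)

  ξb⁺ : Adj G x C[ p₃ ] × Adj G y C[ p₃ ]
  ξb⁺ = both-adjacent qb p₃ qb-in (trans (C-fwd (toℕ pb) Ib p₀<m) (C-fwd-lookup qb (toℕ<n pb)))

  open Segments p₀ p₁ p₂ p₃
    (+-monoʳ-≤ p₀ A≤B) (≤-trans (≤-reflexive (+-assoc p₀ B Ib)) (+-monoʳ-≤ p₀ B+Ib≤m))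
    (proj₁ ξa) (proj₂ ξa⁺) (proj₁ ξb) (proj₂ ξb) (proj₁ ξb⁺) (proj₂ ξb⁺)

  interior-a : ∀ {v} → InInterior G cs x y pa qa v → ∃[ t ] Inside p₀ p₁ t × C[ t ] ≡ v
  interior-a (k , (0<d , d<A) , refl) =
    p₀ + fwd m p₀ (toℕ k) , (m<m+n p₀ 0<d , +-monoʳ-< p₀ d<A) , C-fwd-lookup k p₀<m

  interior-b : ∀ {v} → InInterior G cs x y pb qb v → ∃[ t ] Inside p₂ p₃ t × C[ t ] ≡ v
  interior-b (k , (0<d , d<Ib) , refl) =
    p₂ + fwd m (toℕ pb) (toℕ k) , (m<m+n p₂ 0<d , +-monoʳ-< p₂ d<Ib) ,
    trans (C-fwd (toℕ pb) (fwd m (toℕ pb) (toℕ k)) p₀<m) (C-fwd-lookup k (toℕ<n pb))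

  Intermediate : List (Fin n) → Set
  Intermediate = IsIntermediate G cs x y ps pa qa pb qb

  intermediate⇒detour : ∀ {L} → Intermediate L →
    ∃[ z ] ∃[ w ] ∃[ mid ] Inside p₀ p₁ z × Inside p₂ p₃ w × Detour C[ z ] C[ w ] mid
                          × L ≡ C[ z ] ∷ mid ∷ʳ C[ w ]
  intermediate⇒detour ((_ , L-unique , L-linked) , _ , _ , hd , lst , z-in , w-in , only-ends)
    with interior-a z-in | interior-b w-in
  ... | z , z∈a , refl | w , w∈b , refl
    with split-path {G = G} L-unique L-linked hd lst (interiors-distinct z∈a w∈b)
  ... | mid , refl , walk , mid-unique , z∉mid , w∉mid =
    z , w , mid , z∈a , w∈b , record { walk = walk ; unique = mid-unique ; offC = offC ; offP = offP } , refl
    where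
    interior : ∀ {v} → v ∈ mid → v ∈ cs ⊎ v ∈ ps → ⊥
    interior p q with only-ends _ (there (∈-++⁺ˡ p)) q
    ... | inj₁ refl = z∉mid p
    ... | inj₂ refl = w∉mid p
    offC : ∀ {v} → v ∈ mid → v ∉ cs
    offC p = interior p ∘ inj₁
    offP : Disjoint mid ps
    offP (p , q) = interior p (inj₂ q)

  from-positions : ∀ {a} → a + (p₂ + p₀) ≤ p₁ + p₃ → a ≤ A + Ib
  from-positions {a} le =
    +-cancelʳ-≤ (p₂ + p₀) a (A + Ib) (subst (a + (p₂ + p₀) ≤_) (recentre p₀ A B Ib) le)
    where
    recentre : ∀ p₀ A B Ib → p₀ + A + (p₀ + B + Ib) ≡ A + Ib + (p₀ + B + p₀)
    recentre = solve-∀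

  intermediate-path-bound : ∀ L → Intermediate L → 2 * (length ps ∸ 1) + 2 * (length L ∸ 1) + 4 ≤ A + Ib
  intermediate-path-bound L isL with intermediate⇒detour isL
  ... | z , w , mid , z∈a , w∈b , D , refl with intermediate-bound z∈a w∈b D
  ...   | lower , upper =
    subst (_≤ A + Ib)
      (trans (count (length ps′) (length mid)) (cong (λ l → 2 * length ps′ + 2 * l + 4) (sym (length-++ mid))))
      (from-positions (sandwich {h = length ps + (length mid + 2)} {p₂ + p₀} 0 lower ≤-refl upper))
    where
    count : ∀ l k → suc l + (k + 2) + (suc l + (k + 2)) + 0 ≡ 2 * l + 2 * (k + 1) + 4
    count = solve-∀

  open ChordCounting (length ps + 2) (p₂ + p₀) (p₁ + p₃) Chord chord-bound crossing-chords

  Edge : List (Fin n) → ℕ × ℕ → Set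
  Edge L P = Chord P × L ≡ C[ proj₁ P ] ∷ C[ proj₂ P ] ∷ []

  intermediate-edge : ∀ {L} → Intermediate L → length L ∸ 1 ≡ 1 → ∃[ P ] Edge L P
  intermediate-edge isL len with intermediate⇒detour isL
  ... | z , w , [] , z∈a , w∈b , D , refl with Detour.walk D
  ...   | e ∷ [] = (z , w) , (z∈a , w∈b , e) , refl
  intermediate-edge isL len | z , w , v ∷ mid , _ , _ , _ , refl =
    ⊥-elim (m+1+n≢0 (length mid) (trans (sym (length-++ mid)) (suc-injective len)))

  distinct-edges : ∀ {L₁ L₂ P₁ P₂} → Edge L₁ P₁ → Edge L₂ P₂ → L₁ ≢ L₂ → P₁ ≢ P₂
  distinct-edges (_ , refl) (_ , refl) L₁≢L₂ refl = L₁≢L₂ refl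

  edge-count : ∀ l k → suc l + 2 + (suc l + 2) + k ≡ 2 * l + suc k + 5
  edge-count = solve-∀

  count-edges : ∀ Ls → Unique Ls → 1 ≤ length Ls → length Ls ≤ 3 →
    (∀ {L} → L ∈ Ls → ∃[ P ] Edge L P) → 2 * length ps′ + length Ls + 5 ≤ A + Ib
  count-edges (L₁ ∷ []) _ _ _ edge with edge (here refl)
  ... | _ , e₁ = subst (_≤ A + Ib) (edge-count (length ps′) 0) (from-positions (one-chord (proj₁ e₁)))
  count-edges (L₁ ∷ L₂ ∷ []) ((L₁≢L₂ ∷ []) ∷ _) _ _ edge
    with edge (here refl) | edge (there (here refl))
  ... | _ , e₁ | _ , e₂ =
    subst (_≤ A + Ib) (edge-count (length ps′) 1)
      (from-positions (two-chords (proj₁ e₁) (proj₁ e₂) (distinct-edges e₁ e₂ L₁≢L₂)))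
  count-edges (L₁ ∷ L₂ ∷ L₃ ∷ []) ((L₁≢L₂ ∷ L₁≢L₃ ∷ []) ∷ (L₂≢L₃ ∷ []) ∷ _) _ _ edge
    with edge (here refl) | edge (there (here refl)) | edge (there (there (here refl)))
  ... | _ , e₁ | _ , e₂ | _ , e₃ =
    subst (_≤ A + Ib) (edge-count (length ps′) 2)
      (from-positions (three-chords (proj₁ e₁) (proj₁ e₂) (proj₁ e₃)
        (distinct-edges e₁ e₂ L₁≢L₂) (distinct-edges e₁ e₃ L₁≢L₃)
        (distinct-edges e₂ e₃ L₂≢L₃)))
  count-edges (_ ∷ _ ∷ _ ∷ _ ∷ _) _ _ (s≤s (s≤s (s≤s ()))) _

  intermediate-edges-bound : ∀ i → 1 ≤ i → i ≤ 3 → (∀ L → Intermediate L → length L ∸ 1 ≡ 1) →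
    (∃[ Ls ] Unique Ls × (length Ls ≡ i) × (∀ L → Intermediate L ⇔ L ∈ Ls)) →
    2 * (length ps ∸ 1) + i + 5 ≤ A + Ib
  intermediate-edges-bound _ 1≤i i≤3 edges (Ls , Ls-unique , refl , listed) =
    count-edges Ls Ls-unique 1≤i i≤3 λ {L} L∈Ls →
      let isL = Equivalence.from (listed L) L∈Ls in intermediate-edge isL (edges L isL)

  independent-edges-bound : (∀ L → Intermediate L → length L ∸ 1 ≡ 1) →
    (∃[ L₁ ] ∃[ L₂ ] Intermediate L₁ × Intermediate L₂ × (∀ v → v ∈ L₁ → v ∉ L₂)) →
    2 * (length ps ∸ 1) + 8 ≤ A + Ib
  independent-edges-bound edges (L₁ , L₂ , i₁ , i₂ , disjoint)
    with intermediate-edge i₁ (edges L₁ i₁) | intermediate-edge i₂ (edges L₂ i₂)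
  ... | (z₁ , w₁) , c₁ , refl | (z₂ , w₂) , c₂ , refl =
    subst (_≤ A + Ib) (trans (edge-count (length ps′) 2) (+-assoc (2 * length ps′) 3 5))
      (from-positions (independent-chords c₁ c₂
        ( (λ z₁≡z₂ → disjoint _ (here refl) (here (cong C[_] z₁≡z₂)))
        , (λ w₁≡w₂ → disjoint _ (there (here refl)) (there (here (cong C[_] w₁≡w₂)))))))

lemma2 : ∀ {n} (G : SimpleGraph n) (cs ps : List (Fin n)) (x y : Fin n) →
  IsLongestCycle G cs →
  IsLongestPathOutside G cs ps →
  head ps ≡ just x → last ps ≡ just y →
  (∀ v → v ∈ cs → (Adj G x v ⇔ Adj G y v)) →
  (∃[ u ] ∃[ v ] (u ≢ v) × (u ∈ cs) × (v ∈ cs) × Adj G x u × Adj G x v) →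
  ∀ pa qa pb qb →
  IsElemSeg G cs x y pa qa → IsElemSeg G cs x y pb qb → pa ≢ pb →
  -- (a1)
  ((L : List (Fin n)) → IsIntermediate G cs x y ps pa qa pb qb L →
     2 * (length ps ∸ 1) + 2 * (length L ∸ 1) + 4
       ≤ segLen G cs x y pa qa + segLen G cs x y pb qb)
  -- (a2)
  × ((i : ℕ) → 1 ≤ i → i ≤ 3 →
     (∀ L → IsIntermediate G cs x y ps pa qa pb qb L → length L ∸ 1 ≡ 1) →
     (∃[ Ls ] Unique Ls × (length Ls ≡ i)
         × (∀ L → IsIntermediate G cs x y ps pa qa pb qb L ⇔ L ∈ Ls)) →
     2 * (length ps ∸ 1) + i + 5
       ≤ segLen G cs x y pa qa + segLen G cs x y pb qb)
  -- (a3)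
  × ((∀ L → IsIntermediate G cs x y ps pa qa pb qb L → length L ∸ 1 ≡ 1) →
     (∃[ L₁ ] ∃[ L₂ ] IsIntermediate G cs x y ps pa qa pb qb L₁
         × IsIntermediate G cs x y ps pa qa pb qb L₂
         × (∀ v → v ∈ L₁ → v ∉ L₂)) →
     2 * (length ps ∸ 1) + 8
       ≤ segLen G cs x y pa qa + segLen G cs x y pb qb)
lemma2 G .(c₀ ∷ rest) (x ∷ ps′) .x y ((_ , cs-unique , c₀ , rest , refl , cs-linked) , longest)
  (((_ , P-unique , P-linked) , P-offC) , _) refl last≡y same-neighbours _
  pa qa pb qb (_ , pa-in , qa-in , between-a) (_ , pb-in , qb-in , between-b) pa≢pb =
  intermediate-path-bound , intermediate-edges-bound , independent-edges-bound
  where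
  open Configuration G cs-unique cs-linked longest (linked⇒walk P-linked last≡y) P-unique P-offC same-neighbours
                     pa-in qa-in between-a pb-in qb-in between-b pa≢pb
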